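{- Let $m\ge1$ and let $k_1,\ldots,k_m$, $n_1,\ldots,n_m$ be integers with $n_i \geq k_i \geq 0$ for all $i \in [m]$. Let $M$ be the complement of a $(k_1, \ldots, k_m ; n_1, \ldots, n_m)$ circulant block diagonal matrix, and let $P$ be a partition of the ones in $M$ into combinatorial rectangles. For some $h \in [m]$, put $d_{h} = \gcd(n_{h},k_{h})$. Suppose that $P$ includes $\ell$ rectangles whose row sequences in block $h$ (or, alternatively, whose column sequences in block $h$) are $a^{(1)}, \ldots, a^{(\ell)} \in \mathbb{Z}^{d_{h}}$, and let $a^{(0)}$ denote the all-one vector in $\mathbb{Z}^{d_{h}}$. If the vectors $a^{(0)}, a^{(1)}, \ldots, a^{(\ell)}$ are linearly independent, then $|P| \geq \mathrm{rank}_{\mathbb{R}}(M) + \ell$.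
   Context: For integers $n \ge k \ge 0$, $D_{n,k}$ denotes the $n\times n$ circulant $0,1$ matrix whose first row consists of $n-k$ ones followed by $k$ zeros, each subsequent row being the cyclic shift of the previous row by one position to the right. For integers $n_i \ge k_i \ge 0$ ($i\in[m]$), a matrix is called $(k_1,\ldots,k_m;n_1,\ldots,n_m)$ circulant block diagonal if it is a block matrix with $m$ diagonal blocks whose $i$th diagonal block is $D_{n_i,n_i-k_i}$ and all of whose other entries are zero; rows and columns are indexed by pairs $(i,j)$ with $i\in[m]$, $j\in[n_i]$ (the $j$th row/column of the $i$th block). The complement of a $0,1$ matrix swaps zeros and ones. A combinatorial rectangle of ones is a set $A\times B$ of rows times columns all of whose entries are ones; a partition of the ones into rectangles covers each one-entry exactly once. For a rectangle $R=A\times B$ and $i\in[m]$ with $d_i=\gcd(n_i,k_i)$ (where $\gcd(n,0)=n$), the row sequence of $R$ in block $i$ is $(a_1,\ldots,a_{d_i})$ where $a_t$ is the number of rows $(i,j)\in A$ with $j\equiv t \pmod{d_i}$; the column sequence $(b_1,\ldots,b_{d_i})$ is defined analogously with columns $(i,j)\in B$. $\mathrm{rank}_{\mathbb{R}}$ is the rank over the reals. -}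

module Defs where

open import Data.Bool using (Bool; true; false; if_then_else_; _∧_; not)
open import Data.Nat using (ℕ; zero; suc; _+_; _∸_; _≤ᵇ_; _%_)
open import Data.Nat.GCD using (gcd)
open import Data.Fin using (Fin; toℕ) renaming (zero to fzero; suc to fsuc)
import Data.Fin as Fin
open import Data.Product using (Σ; _,_; _×_)
open import Relation.Binary.PropositionalEquality using (_≡_; refl)
open import Data.List.Relation.Unary.All using (All)
open import Data.List using (List; []; _∷_)
open import Relation.Nullary.Decidable using (⌊_⌋; yes; no)
import Data.Rational as ℚ
open import Data.Rational using (ℚ; 0ℚ; 1ℚ)
open import Data.Integer using (+_)

-- Row/column index set: pairs (i , j) with i ∈ Fin m (block), j ∈ Fin (n i).
-- Indices are 0-based (j ∈ {0..n_i-1} stands for the paper's j+1).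
Idx : (m : ℕ) → (Fin m → ℕ) → Set
Idx m n = Σ (Fin m) (λ i → Fin (n i))

cdiff : ℕ → ℕ → ℕ → ℕ
cdiff n a b = if a ≤ᵇ b then b ∸ a else (b + n) ∸ a

-- Entry of D_{n,k}: row a, column b (0-based) is one iff (b - a) mod n < n - k.
D-entry : (n k : ℕ) → Fin n → Fin n → Bool
D-entry n k a b = not ((n ∸ k) ≤ᵇ cdiff n (toℕ a) (toℕ b))

-- Entry of the (k;n) circulant block diagonal matrix: block i is D_{n_i , n_i - k_i},
-- all off-block entries are zero.
CBD-entry : (m : ℕ) (n k : Fin m → ℕ) → Idx m n → Idx m n → Bool
CBD-entry m n k (i , j) (i' , j') with i Fin.≟ i'
... | yes refl = D-entry (n i) (n i ∸ k i) j j'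
... | no _ = false

M-entry : (m : ℕ) (n k : Fin m → ℕ) → Idx m n → Idx m n → Bool
M-entry m n k r c = not (CBD-entry m n k r c)

M-ℚ : (m : ℕ) (n k : Fin m → ℕ) → Idx m n → Idx m n → ℚ
M-ℚ m n k r c = if M-entry m n k r c then 1ℚ else 0ℚ

record Rect (I : Set) : Set where
  constructor rect
  field
    rowsOf : I → Bool
    colsOf : I → Bool
open Rect public

covers : {I : Set} → Rect I → I → I → Bool
covers R r c = rowsOf R r ∧ colsOf R c

multiplicity : {I : Set} → List (Rect I) → I → I → ℕ
multiplicity [] r c = 0
multiplicity (R ∷ P) r c = (if covers R r c then 1 else 0) + multiplicity P r c

countFin : (n : ℕ) → (Fin n → Bool) → ℕ
countFin zero f = 0
countFin (suc n) f = (if f fzero then 1 else 0) + countFin n (λ j → f (fsuc j))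

-- Sequence (a_1 , ... , a_d) of a subset S ⊆ Fin n of block indices:
-- a_t = #{ j ∈ S : j ≡ t (mod d) }  (0-based t and j).
residueSeq : (n d : ℕ) → (Fin n → Bool) → Fin d → ℕ
residueSeq n zero S ()
residueSeq n (suc d) S t =
  countFin n (λ j → S j ∧ ⌊ (toℕ j % suc d) Data.Nat.≟ toℕ t ⌋)

-- d_h = gcd(n_h , k_h)   (stdlib: gcd n 0 = n)
dBlock : (m : ℕ) (n k : Fin m → ℕ) → Fin m → ℕ
dBlock m n k h = gcd (n h) (k h)

data Side : Set where
  rowSide colSide : Side

blockSeq : (m : ℕ) (n k : Fin m → ℕ) → Side → (h : Fin m) → Rect (Idx m n) → Fin (dBlock m n k h) → ℕ
blockSeq m n k rowSide h R = residueSeq (n h) (dBlock m n k h) (λ j → rowsOf R (h , j))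
blockSeq m n k colSide h R = residueSeq (n h) (dBlock m n k h) (λ j → colsOf R (h , j))

sumFin : (r : ℕ) → (Fin r → ℚ) → ℚ
sumFin zero f = 0ℚ
sumFin (suc r) f = f fzero ℚ.+ sumFin r (λ i → f (fsuc i))

ℕtoℚ : ℕ → ℚ
ℕtoℚ x = (+ x) ℚ./ 1

-- Linear independence over ℚ (equivalently over ℝ) of a family v : Fin r → (J → ℚ)
-- of vectors indexed by an arbitrary coordinate set J.
LinIndep : {J : Set} (r : ℕ) → (Fin r → J → ℚ) → Set
LinIndep {J} r v = (c : Fin r → ℚ) → ((t : J) → sumFin r (λ i → c i ℚ.* v i t) ≡ 0ℚ) → (i : Fin r) → c i ≡ 0ℚ

-- rank(M) ≥ r : some r rows of M are linearly independent (rank = max number of independent rows)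
RankAtLeast : {I : Set} → (I → I → ℚ) → ℕ → Set
RankAtLeast {I} A r = Σ (Fin r → I) (λ ρ → LinIndep r (λ i c → A (ρ i) c))

IsOnesPartition : (m : ℕ) (n k : Fin m → ℕ) → List (Rect (Idx m n)) → Set
IsOnesPartition m n k P =
  All (λ R → (r c : Idx m n) → rowsOf R r ≡ true → colsOf R c ≡ true → M-entry m n k r c ≡ true) P
  × ((r c : Idx m n) → M-entry m n k r c ≡ true → multiplicity P r c ≡ 1)

seqFamily : (m : ℕ) (n k : Fin m → ℕ) → Side → (h : Fin m) → (ℓ : ℕ)
  → (Fin ℓ → Rect (Idx m n)) → Fin (suc ℓ) → Fin (dBlock m n k h) → ℚ
seqFamily m n k side h ℓ R fzero t = ℕtoℚ 1
seqFamily m n k side h ℓ R (fsuc i) t = ℕtoℚ (blockSeq m n k side h (R i) t)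

module Submission where

-- Let u_q, v_q be the row and column indicators of the p rectangles, so M = Σ_q u_q v_qᵀ. For
-- β ∈ ℚ^d with Σ β = 0, extend β d-periodically along block h. Every row and column of M has
-- its ones within block h on a cyclic interval (or all of block h) whose length is a multiple
-- of d, as d divides n_h and k_h; so M annihilates this extension, and through the
-- factorization the vector Φ_β = (β · a_q)_q of pairings with the block-h sequences a_q of all
-- rectangles satisfies Σ_q Φ_β(q) v_q = 0 (row sequences) or Σ_q Φ_β(q) u_q = 0 (column
-- sequences). Now take r independent rows ρ_i of M and suppose r + ℓ > p. A dependency among
-- the r + ℓ + 1 vectors (0, (u_q(ρ_i))_q) and (a^(j) · 1, Φ_{a^(j)}) of ℚ^(1+p) yields α and
-- β = Σ_j μ_j a^(j) with Σ β = 0 and Σ_i α_i u_q(ρ_i) = -Φ_β(q). Pairing with the v_q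
-- (respectively with Φ_β itself) forces α = 0 and Φ_β = 0. Then β is orthogonal to every
-- a^(j), hence to itself, so β = 0 and μ = 0.

open import Defs
open import Data.Nat using (ℕ; suc; _≤_; _+_)
open import Data.Fin using (Fin)
open import Data.List using (List; length; lookup)
open import Function.Definitions using (Injective)
open import Relation.Binary.PropositionalEquality using (_≡_)
open import Data.Rational using (ℚ)

open import Algebra.Bundles using (CommutativeRing)
open import Data.Bool using (Bool; true; false; if_then_else_; _∧_)
open import Data.Bool.Properties using (not-involutive)
open import Data.Fin using (zero; suc; toℕ; _↑ˡ_; _↑ʳ_; splitAt; punchIn; punchOut)
import Data.Fin as Fin
import Data.Fin.Properties as Finₚ
import Data.Integer as ℤ
import Data.Integer.Properties as ℤₚ
open import Data.List using ([]; _∷_)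
open import Data.List.Relation.Unary.All using (All; []; _∷_)
open import Data.Nat using (zero; _∸_; _<_; _≤ᵇ_; _%_; _*_; z<s; s≤s; s≤s⁻¹; _≤?_)
import Data.Nat as ℕ
import Data.Nat.Properties as ℕₚ
open import Data.Nat.DivMod using (_mod_)
import Data.Nat.DivMod as DM
open import Data.Nat.Divisibility using (_∣_; divides; ∣m+n∣m⇒∣n)
open import Data.Nat.GCD using (gcd[m,n]∣m; gcd[m,n]∣n)
open import Data.Product using (Σ-syntax; ∃-syntax; _×_; _,_; proj₁; proj₂)
import Data.Rational as ℚ
open import Data.Rational using (0ℚ; 1ℚ)
import Data.Rational.Properties as ℚₚ
open import Data.Rational.Solver using (module +-*-Solver)
import Data.Rational.Unnormalised as ℚᵘ
import Data.Rational.Unnormalised.Properties as ℚᵘₚ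
open import Data.Sum using (_⊎_; inj₁; inj₂; [_,_]′)
open import Data.Vec.Functional using (_++_)
open import Data.Vec.Functional.Properties using (lookup-++ˡ; lookup-++ʳ)
open import Function using (_∘_)
open import Relation.Binary.Definitions using (tri<; tri≈; tri>)
open import Relation.Binary.PropositionalEquality
  using (_≢_; _≗_; refl; sym; trans; cong; cong₂; subst; module ≡-Reasoning)
open import Relation.Nullary using (Dec; yes; no; contradiction)
open import Relation.Nullary.Decidable using (⌊_⌋; dec-true; dec-false)
open import Algebra.Properties.Group ℚₚ.+-0-group using () renaming (∙-cancelˡ to +-cancelˡ)
open import Algebra.Properties.Semiring.Sum (CommutativeRing.semiring ℚₚ.+-*-commutativeRing)
  using (sum-syntax; sum-cong-≗; ∑-comm; ∑-distrib-+; *-distribˡ-sum; *-distribʳ-sum; sum-replicate-zero; sum-remove)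

𝟙 : Bool → ℚ
𝟙 b = if b then 1ℚ else 0ℚ

𝟙-∧ : ∀ a b → 𝟙 (a ∧ b) ≡ 𝟙 a ℚ.* 𝟙 b
𝟙-∧ true b = sym (ℚₚ.*-identityˡ (𝟙 b))
𝟙-∧ false b = sym (ℚₚ.*-zeroˡ (𝟙 b))

ℕtoℚ-suc : ∀ m → ℕtoℚ (suc m) ≡ 1ℚ ℚ.+ ℕtoℚ m
ℕtoℚ-suc m = ℚₚ.toℚᵘ-injective (begin
    ℚ.toℚᵘ (ℕtoℚ (suc m))                   ≈⟨ ℚₚ.toℚᵘ-fromℚᵘ (ℕtoℚᵘ (suc m)) ⟩
    ℕtoℚᵘ (suc m)                            ≈⟨ ℚᵘ.*≡* (ℕtoℚᵘ-suc-numerator m) ⟨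
    ℚᵘ.1ℚᵘ ℚᵘ.+ ℕtoℚᵘ m                      ≈⟨ ℚᵘₚ.+-congʳ ℚᵘ.1ℚᵘ (ℚₚ.toℚᵘ-fromℚᵘ (ℕtoℚᵘ m)) ⟨
    ℚᵘ.1ℚᵘ ℚᵘ.+ ℚ.toℚᵘ (ℕtoℚ m)              ≈⟨ ℚₚ.toℚᵘ-homo-+ 1ℚ (ℕtoℚ m) ⟨
    ℚ.toℚᵘ (1ℚ ℚ.+ ℕtoℚ m)                   ∎)
  where
  open ℚᵘₚ.≃-Reasoning
  ℕtoℚᵘ : ℕ → ℚᵘ.ℚᵘ
  ℕtoℚᵘ n = ℚᵘ.mkℚᵘ (ℤ.+ n) 0
  ℕtoℚᵘ-suc-numerator : ∀ m → ℚᵘ.↥ (ℚᵘ.1ℚᵘ ℚᵘ.+ ℕtoℚᵘ m) ℤ.* ℚᵘ.↧ (ℕtoℚᵘ (suc m))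
                                ≡ ℚᵘ.↥ (ℕtoℚᵘ (suc m)) ℤ.* ℚᵘ.↧ (ℚᵘ.1ℚᵘ ℚᵘ.+ ℕtoℚᵘ m)
  ℕtoℚᵘ-suc-numerator m rewrite ℕₚ.*-identityʳ m | ℤₚ.+◃n≡+n m | ℕₚ.*-identityʳ (suc m) = refl

ℕtoℚ-𝟙+ : ∀ b m → ℕtoℚ ((if b then 1 else 0) + m) ≡ 𝟙 b ℚ.+ ℕtoℚ m
ℕtoℚ-𝟙+ true m = ℕtoℚ-suc m
ℕtoℚ-𝟙+ false m = sym (ℚₚ.+-identityˡ (ℕtoℚ m))

x≡0⇒x*y≡0 : ∀ {x} y → x ≡ 0ℚ → x ℚ.* y ≡ 0ℚ
x≡0⇒x*y≡0 y refl = ℚₚ.*-zeroˡ y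

y≡0⇒x*y≡0 : ∀ x {y} → y ≡ 0ℚ → x ℚ.* y ≡ 0ℚ
y≡0⇒x*y≡0 x refl = ℚₚ.*-zeroʳ x

x*𝟙[b]≡x : ∀ x {b} → b ≡ true → x ℚ.* 𝟙 b ≡ x
x*𝟙[b]≡x x refl = ℚₚ.*-identityʳ x

x*𝟙[b]≡0 : ∀ x {b} → b ≡ false → x ℚ.* 𝟙 b ≡ 0ℚ
x*𝟙[b]≡0 x refl = ℚₚ.*-zeroʳ x

x+y≡0∧x≡0⇒y≡0 : ∀ {x y} → x ℚ.+ y ≡ 0ℚ → x ≡ 0ℚ → y ≡ 0ℚ
x+y≡0∧x≡0⇒y≡0 {y = y} x+y≡0 refl = trans (sym (ℚₚ.+-identityˡ y)) x+y≡0

x≢0⇒0<x*x : ∀ x → x ≢ 0ℚ → 0ℚ ℚ.< x ℚ.* x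
x≢0⇒0<x*x x x≢0 with ℚₚ.<-cmp x 0ℚ
... | tri< x<0 _ _ = ℚₚ.positive⁻¹ (x ℚ.* x) {{ℚₚ.neg*neg⇒pos x {{ℚ.negative x<0}} x {{ℚ.negative x<0}}}}
... | tri≈ _ x≡0 _ = contradiction x≡0 x≢0
... | tri> _ _ x>0 = ℚₚ.positive⁻¹ (x ℚ.* x) {{ℚₚ.pos*pos⇒pos x {{ℚ.positive x>0}} x {{ℚ.positive x>0}}}}

0≤x*x : ∀ x → 0ℚ ℚ.≤ x ℚ.* x
0≤x*x x with x ℚ.≟ 0ℚ
... | yes refl = ℚₚ.≤-refl
... | no x≢0 = ℚₚ.<⇒≤ (x≢0⇒0<x*x x x≢0)

x*x≡0⇒x≡0 : ∀ x → x ℚ.* x ≡ 0ℚ → x ≡ 0ℚ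
x*x≡0⇒x≡0 x x*x≡0 with x ℚ.≟ 0ℚ
... | yes x≡0 = x≡0
... | no x≢0 = contradiction (x≢0⇒0<x*x x x≢0) (ℚₚ.<-irrefl (sym x*x≡0))

x≢0∧y≢0⇒x*y≢0 : ∀ {x y} → x ≢ 0ℚ → y ≢ 0ℚ → x ℚ.* y ≢ 0ℚ
x≢0∧y≢0⇒x*y≢0 {x} {y} x≢0 y≢0 x*y≡0 = y≢0 (begin
  y                        ≡⟨ ℚₚ.*-identityˡ y ⟨
  1ℚ ℚ.* y                 ≡⟨ cong (ℚ._* y) (ℚₚ.*-inverseˡ x) ⟨
  (ℚ.1/ x ℚ.* x) ℚ.* y     ≡⟨ ℚₚ.*-assoc (ℚ.1/ x) x y ⟩
  ℚ.1/ x ℚ.* (x ℚ.* y)     ≡⟨ cong (ℚ.1/ x ℚ.*_) x*y≡0 ⟩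
  ℚ.1/ x ℚ.* 0ℚ            ≡⟨ ℚₚ.*-zeroʳ (ℚ.1/ x) ⟩
  0ℚ                       ∎)
  where
  open ≡-Reasoning
  instance
    x-nonZero : ℚ.NonZero x
    x-nonZero = ℚ.≢-nonZero x≢0

sumFin≡∑ : ∀ n (f : Fin n → ℚ) → sumFin n f ≡ ∑[ i < n ] f i
sumFin≡∑ zero f = refl
sumFin≡∑ (suc n) f = cong (f zero ℚ.+_) (sumFin≡∑ n (f ∘ suc))

∑-zero : ∀ n {f : Fin n → ℚ} → (∀ i → f i ≡ 0ℚ) → ∑[ i < n ] f i ≡ 0ℚ
∑-zero n f≡0 = trans (sum-cong-≗ f≡0) (sum-replicate-zero n)

∑-single : ∀ {n} (f : Fin n → ℚ) i → (∀ j → j ≢ i → f j ≡ 0ℚ) → ∑[ j < n ] f j ≡ f i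
∑-single {suc n} f i f≡0 = begin
  ∑[ j < suc n ] f j                    ≡⟨ sum-remove f ⟩
  f i ℚ.+ ∑[ j < n ] f (punchIn i j)    ≡⟨ cong (f i ℚ.+_) (∑-zero n (λ j → f≡0 _ (Finₚ.punchInᵢ≢i i j))) ⟩
  f i ℚ.+ 0ℚ                            ≡⟨ ℚₚ.+-identityʳ (f i) ⟩
  f i                                   ∎
  where open ≡-Reasoning

∑-↑ : ∀ r {s} (f : Fin (r + s) → ℚ) → ∑[ k < r + s ] f k ≡ ∑[ i < r ] f (i ↑ˡ s) ℚ.+ ∑[ j < s ] f (r ↑ʳ j)
∑-↑ zero f = sym (ℚₚ.+-identityˡ _)
∑-↑ (suc r) f = trans (cong (f zero ℚ.+_) (∑-↑ r (f ∘ suc))) (sym (ℚₚ.+-assoc (f zero) _ _))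

∑-∑-assoc : ∀ {a b} (x : Fin a → ℚ) (B : Fin a → Fin b → ℚ) (y : Fin b → ℚ) →
  ∑[ i < a ] (x i ℚ.* ∑[ j < b ] (B i j ℚ.* y j)) ≡ ∑[ j < b ] (∑[ i < a ] (x i ℚ.* B i j) ℚ.* y j)
∑-∑-assoc {a} {b} x B y = begin
  ∑[ i < a ] (x i ℚ.* ∑[ j < b ] (B i j ℚ.* y j))     ≡⟨ sum-cong-≗ (λ i → *-distribˡ-sum (x i) (λ j → B i j ℚ.* y j)) ⟩
  ∑[ i < a ] ∑[ j < b ] (x i ℚ.* (B i j ℚ.* y j))     ≡⟨ ∑-comm (λ i j → x i ℚ.* (B i j ℚ.* y j)) ⟩
  ∑[ j < b ] ∑[ i < a ] (x i ℚ.* (B i j ℚ.* y j))     ≡⟨ sum-cong-≗ (λ j → sum-cong-≗ (λ i → sym (ℚₚ.*-assoc (x i) (B i j) (y j)))) ⟩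
  ∑[ j < b ] ∑[ i < a ] ((x i ℚ.* B i j) ℚ.* y j)     ≡⟨ sum-cong-≗ (λ j → *-distribʳ-sum (y j) (λ i → x i ℚ.* B i j)) ⟨
  ∑[ j < b ] (∑[ i < a ] (x i ℚ.* B i j) ℚ.* y j)     ∎
  where open ≡-Reasoning

∑-cancel : ∀ {n} (f g h : Fin n → ℚ) → (∀ q → f q ℚ.+ g q ≡ 0ℚ) →
  ∑[ q < n ] (f q ℚ.* h q) ≡ 0ℚ → ∑[ q < n ] (g q ℚ.* h q) ≡ 0ℚ
∑-cancel {n} f g h f+g≡0 = x+y≡0∧x≡0⇒y≡0 (begin
  ∑[ q < n ] (f q ℚ.* h q) ℚ.+ ∑[ q < n ] (g q ℚ.* h q)  ≡⟨ ∑-distrib-+ (λ q → f q ℚ.* h q) (λ q → g q ℚ.* h q) ⟨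
  ∑[ q < n ] (f q ℚ.* h q ℚ.+ g q ℚ.* h q)               ≡⟨ sum-cong-≗ (λ q → ℚₚ.*-distribʳ-+ (h q) (f q) (g q)) ⟨
  ∑[ q < n ] ((f q ℚ.+ g q) ℚ.* h q)                     ≡⟨ ∑-zero n (λ q → x≡0⇒x*y≡0 (h q) (f+g≡0 q)) ⟩
  0ℚ                                                     ∎)
  where open ≡-Reasoning

∑-nonNeg : ∀ n {f : Fin n → ℚ} → (∀ i → 0ℚ ℚ.≤ f i) → 0ℚ ℚ.≤ ∑[ i < n ] f i
∑-nonNeg zero _ = ℚₚ.≤-refl
∑-nonNeg (suc n) f≥0 = ℚₚ.+-mono-≤ (f≥0 zero) (∑-nonNeg n (f≥0 ∘ suc))

∑-nonNeg≡0⇒≡0 : ∀ {n} (f : Fin n → ℚ) → (∀ i → 0ℚ ℚ.≤ f i) → ∑[ i < n ] f i ≡ 0ℚ → ∀ i → f i ≡ 0ℚ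
∑-nonNeg≡0⇒≡0 {suc n} f f≥0 ∑≡0 i = ℚₚ.≤-antisym (begin
  f i                                   ≡⟨ ℚₚ.+-identityʳ (f i) ⟨
  f i ℚ.+ 0ℚ                            ≤⟨ ℚₚ.+-monoʳ-≤ (f i) (∑-nonNeg n (f≥0 ∘ punchIn i)) ⟩
  f i ℚ.+ ∑[ j < n ] f (punchIn i j)    ≡⟨ sum-remove f ⟨
  ∑[ j < suc n ] f j                    ≡⟨ ∑≡0 ⟩
  0ℚ                                    ∎) (f≥0 i)
  where open ℚₚ.≤-Reasoning

∑-squares≡0⇒≡0 : ∀ {n} (x : Fin n → ℚ) → ∑[ i < n ] (x i ℚ.* x i) ≡ 0ℚ → ∀ i → x i ≡ 0ℚ
∑-squares≡0⇒≡0 x ∑≡0 i = x*x≡0⇒x≡0 (x i) (∑-nonNeg≡0⇒≡0 (λ j → x j ℚ.* x j) (λ j → 0≤x*x (x j)) ∑≡0 i)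

ones : ∀ {d} → Fin d → ℚ
ones _ = 1ℚ

infix 8 _·_
_·_ : ∀ {d} → (Fin d → ℚ) → (Fin d → ℚ) → ℚ
_·_ {d} x y = ∑[ t < d ] (x t ℚ.* y t)

·-comm : ∀ {d} (x y : Fin d → ℚ) → x · y ≡ y · x
·-comm x y = sum-cong-≗ (λ t → ℚₚ.*-comm (x t) (y t))

combination : ∀ {s d} → (Fin s → ℚ) → (Fin s → Fin d → ℚ) → Fin d → ℚ
combination {s} μ A t = ∑[ j < s ] (μ j ℚ.* A j t)

combination-· : ∀ {s d} (μ : Fin s → ℚ) (A : Fin s → Fin d → ℚ) y →
  ∑[ j < s ] (μ j ℚ.* (A j · y)) ≡ combination μ A · y
combination-· μ A y = ∑-∑-assoc μ A y

NontrivialRelation : ∀ {N E} → (Fin N → Fin E → ℚ) → Set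
NontrivialRelation {N} {E} w =
  Σ[ c ∈ (Fin N → ℚ) ] (∀ e → ∑[ i < N ] (c i ℚ.* w i e) ≡ 0ℚ) × ∃[ i ] c i ≢ 0ℚ

relation-of-zero-head : ∀ {N E} (w : Fin (suc N) → Fin E → ℚ) → (∀ e → w zero e ≡ 0ℚ) → NontrivialRelation w
relation-of-zero-head {N} w w₀≡0 = c , relation , zero , ℚₚ.1≢0
  where
  c : Fin (suc N) → ℚ
  c zero = 1ℚ
  c (suc _) = 0ℚ
  relation : ∀ e → ∑[ i < suc N ] (c i ℚ.* w i e) ≡ 0ℚ
  relation e = cong₂ ℚ._+_ (trans (ℚₚ.*-identityˡ (w zero e)) (w₀≡0 e)) (∑-zero N (λ i → ℚₚ.*-zeroˡ (w (suc i) e)))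

module Elimination {N E : ℕ} (w : Fin (suc N) → Fin (suc E) → ℚ) (e : Fin (suc E)) where

  pivot : ℚ
  pivot = w zero e

  reduced : Fin N → Fin (suc E) → ℚ
  reduced j x = pivot ℚ.* w (suc j) x ℚ.- w (suc j) e ℚ.* w zero x

  reduced-e≡0 : ∀ j → reduced j e ≡ 0ℚ
  reduced-e≡0 j = solve 2 (λ a b → a :* b :- b :* a := con 0ℚ) refl pivot (w (suc j) e)
    where open +-*-Solver

  eliminated : Fin N → Fin E → ℚ
  eliminated j x = reduced j (punchIn e x)

  relation-by-pivot : pivot ≢ 0ℚ → NontrivialRelation eliminated → NontrivialRelation w
  relation-by-pivot pivot≢0 (c′ , relation′ , i , c′ᵢ≢0) = c , relation , suc i , x≢0∧y≢0⇒x*y≢0 pivot≢0 c′ᵢ≢0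
    where
    K : ℚ
    K = ∑[ j < N ] (c′ j ℚ.* w (suc j) e)
    c : Fin (suc N) → ℚ
    c zero = ℚ.- K
    c (suc j) = pivot ℚ.* c′ j
    reduced-relation : ∀ x → ∑[ j < N ] (c′ j ℚ.* reduced j x) ≡ 0ℚ
    reduced-relation x with e Finₚ.≟ x
    ... | yes refl = ∑-zero N (λ j → y≡0⇒x*y≡0 (c′ j) (reduced-e≡0 j))
    ... | no e≢x = subst (λ y → ∑[ j < N ] (c′ j ℚ.* reduced j y) ≡ 0ℚ)
                         (Finₚ.punchIn-punchOut e≢x) (relation′ (punchOut e≢x))
    relation : ∀ x → ∑[ k < suc N ] (c k ℚ.* w k x) ≡ 0ℚ
    relation x = begin
      ℚ.- K ℚ.* w zero x ℚ.+ ∑[ j < N ] ((pivot ℚ.* c′ j) ℚ.* w (suc j) x)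
        ≡⟨ cong (ℚ.- K ℚ.* w zero x ℚ.+_) (sum-cong-≗ (λ j → regroup pivot (c′ j) (w (suc j) x) (w (suc j) e) (w zero x))) ⟩
      ℚ.- K ℚ.* w zero x ℚ.+ ∑[ j < N ] (c′ j ℚ.* reduced j x ℚ.+ (c′ j ℚ.* w (suc j) e) ℚ.* w zero x)
        ≡⟨ cong (ℚ.- K ℚ.* w zero x ℚ.+_) (∑-distrib-+ (λ j → c′ j ℚ.* reduced j x) (λ j → (c′ j ℚ.* w (suc j) e) ℚ.* w zero x)) ⟩
      ℚ.- K ℚ.* w zero x ℚ.+ (∑[ j < N ] (c′ j ℚ.* reduced j x) ℚ.+ ∑[ j < N ] ((c′ j ℚ.* w (suc j) e) ℚ.* w zero x))
        ≡⟨ cong₂ (λ a b → ℚ.- K ℚ.* w zero x ℚ.+ (a ℚ.+ b)) (reduced-relation x) (sym (*-distribʳ-sum (w zero x) (λ j → c′ j ℚ.* w (suc j) e))) ⟩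
      ℚ.- K ℚ.* w zero x ℚ.+ (0ℚ ℚ.+ K ℚ.* w zero x)
        ≡⟨ solve 2 (λ k a → :- k :* a :+ (con 0ℚ :+ k :* a) := con 0ℚ) refl K (w zero x) ⟩
      0ℚ ∎
      where
      open ≡-Reasoning
      open +-*-Solver
      regroup : ∀ p cⱼ a b z → (p ℚ.* cⱼ) ℚ.* a ≡ cⱼ ℚ.* (p ℚ.* a ℚ.- b ℚ.* z) ℚ.+ (cⱼ ℚ.* b) ℚ.* z
      regroup = solve 5 (λ p cⱼ a b z → (p :* cⱼ) :* a := cⱼ :* (p :* a :- b :* z) :+ (cⱼ :* b) :* z) refl

nontrivialRelation : ∀ {N E} → E < N → (w : Fin N → Fin E → ℚ) → NontrivialRelation w
nontrivialRelation {suc N} {zero} _ w = relation-of-zero-head w (λ ())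
nontrivialRelation {suc N} {suc E} (s≤s E<N) w with Finₚ.all? (λ e → w zero e ℚ.≟ 0ℚ)
... | yes w₀≡0 = relation-of-zero-head w w₀≡0
... | no w₀≢0 with Finₚ.¬∀⟶∃¬ (suc E) (λ e → w zero e ≡ 0ℚ) (λ e → w zero e ℚ.≟ 0ℚ) w₀≢0
...   | e , pivot≢0 = relation-by-pivot pivot≢0 (nontrivialRelation E<N eliminated)
  where open Elimination w e

independent⇒length≤dim : ∀ {N E} (w : Fin N → Fin E → ℚ) → LinIndep N w → N ≤ E
independent⇒length≤dim {N} {E} w independent with N ≤? E
... | yes N≤E = N≤E
... | no N≰E with nontrivialRelation (ℕₚ.≰⇒> N≰E) w
...   | c , relation , i , cᵢ≢0 = contradiction (independent c (λ e → trans (sumFin≡∑ N (λ i → c i ℚ.* w i e)) (relation e)) i) cᵢ≢0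

Factorizes : ∀ {I : Set} {p} → (I → I → ℚ) → (Fin p → I → ℚ) → (Fin p → I → ℚ) → Set
Factorizes {I} {p} M u v = ∀ (ρ c : I) → M ρ c ≡ ∑[ q < p ] (u q ρ ℚ.* v q c)

Factorizes-transpose : ∀ {I : Set} {p} {M : I → I → ℚ} {u v : Fin p → I → ℚ} →
  Factorizes M u v → Factorizes (λ ρ c → M c ρ) v u
Factorizes-transpose {u = u} {v} M≡uv ρ c = trans (M≡uv c ρ) (sum-cong-≗ (λ q → ℚₚ.*-comm (u q c) (v q ρ)))

rowCombination : ∀ {I : Set} {p s} {M : I → I → ℚ} {u v : Fin p → I → ℚ} → Factorizes M u v →
  ∀ (σ : Fin s → I) (g : Fin s → ℚ) c →
  ∑[ j < s ] (g j ℚ.* M (σ j) c) ≡ ∑[ q < p ] (∑[ j < s ] (g j ℚ.* u q (σ j)) ℚ.* v q c)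
rowCombination {u = u} {v} M≡uv σ g c =
  trans (sum-cong-≗ (λ j → cong (g j ℚ.*_) (M≡uv (σ j) c))) (∑-∑-assoc g (λ j q → u q (σ j)) (λ q → v q c))

Annihilates : ∀ {I : Set} {p d} → (Fin p → Fin d → ℚ) → (Fin p → I → ℚ) → Set
Annihilates {p = p} X w = ∀ β → β · ones ≡ 0ℚ → ∀ c → ∑[ q < p ] ((β · X q) ℚ.* w q c) ≡ 0ℚ

module RankBound {I : Set} {p d ℓ r : ℕ} {M : I → I → ℚ} {u v : Fin p → I → ℚ} (M≡uv : Factorizes M u v)
  (X : Fin p → Fin d → ℚ) (sel : Fin ℓ → Fin p) (A : Fin (suc ℓ) → Fin d → ℚ)
  (A-ones : A zero ≗ ones) (A-sel : ∀ i → A (suc i) ≗ X (sel i)) (A-independent : LinIndep (suc ℓ) A)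
  (annihilates : Annihilates X v ⊎ Annihilates X u)
  (ρ : Fin r → I) (ρ-independent : LinIndep r (M ∘ ρ)) where

  rowMix : (Fin r → ℚ) → Fin p → ℚ
  rowMix α q = ∑[ i < r ] (α i ℚ.* u q (ρ i))

  rowMix-zero : ∀ α → (∀ i → α i ≡ 0ℚ) → ∀ q → rowMix α q ≡ 0ℚ
  rowMix-zero α α≡0 q = ∑-zero r (λ i → x≡0⇒x*y≡0 (u q (ρ i)) (α≡0 i))

  rowMix-annihilates⇒zero : ∀ α → (∀ c → ∑[ q < p ] (rowMix α q ℚ.* v q c) ≡ 0ℚ) → ∀ i → α i ≡ 0ℚ
  rowMix-annihilates⇒zero α annihilated = ρ-independent α (λ c → begin
    sumFin r (λ i → α i ℚ.* M (ρ i) c)    ≡⟨ sumFin≡∑ r (λ i → α i ℚ.* M (ρ i) c) ⟩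
    ∑[ i < r ] (α i ℚ.* M (ρ i) c)        ≡⟨ rowCombination {M = M} {u} {v} M≡uv ρ α c ⟩
    ∑[ q < p ] (rowMix α q ℚ.* v q c)     ≡⟨ annihilated c ⟩
    0ℚ                                    ∎)
    where open ≡-Reasoning

  module _ (α : Fin r → ℚ) (β : Fin d → ℚ) (β-balanced : β · ones ≡ 0ℚ)
           (relation : ∀ q → rowMix α q ℚ.+ β · X q ≡ 0ℚ) where

    relation-swapped : ∀ q → β · X q ℚ.+ rowMix α q ≡ 0ℚ
    relation-swapped q = trans (ℚₚ.+-comm (β · X q) (rowMix α q)) (relation q)

    trivial-if-annihilates-v : Annihilates X v → (∀ i → α i ≡ 0ℚ) × (∀ q → β · X q ≡ 0ℚ)
    trivial-if-annihilates-v X-annihilates-v = α≡0 , β⊥X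
      where
      α≡0 : ∀ i → α i ≡ 0ℚ
      α≡0 = rowMix-annihilates⇒zero α
        (λ c → ∑-cancel (λ q → β · X q) (rowMix α) (λ q → v q c) relation-swapped (X-annihilates-v β β-balanced c))
      β⊥X : ∀ q → β · X q ≡ 0ℚ
      β⊥X q = x+y≡0∧x≡0⇒y≡0 (relation q) (rowMix-zero α α≡0 q)

    trivial-if-annihilates-u : Annihilates X u → (∀ i → α i ≡ 0ℚ) × (∀ q → β · X q ≡ 0ℚ)
    trivial-if-annihilates-u X-annihilates-u = α≡0 , β⊥X
      where
      -- Annihilation makes rowMix α orthogonal to β · X; since rowMix α = - β · X, so is β · X itself.
      mixed≡0 : ∑[ q < p ] (rowMix α q ℚ.* β · X q) ≡ 0ℚ
      mixed≡0 = trans (sym (∑-∑-assoc α (λ i q → u q (ρ i)) (λ q → β · X q)))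
        (∑-zero r (λ i → y≡0⇒x*y≡0 (α i) (trans (sum-cong-≗ (λ q → ℚₚ.*-comm (u q (ρ i)) (β · X q)))
                                                 (X-annihilates-u β β-balanced (ρ i)))))
      β⊥X : ∀ q → β · X q ≡ 0ℚ
      β⊥X = ∑-squares≡0⇒≡0 (λ q → β · X q) (∑-cancel (rowMix α) (λ q → β · X q) (λ q → β · X q) relation mixed≡0)
      rowMix≡0 : ∀ q → rowMix α q ≡ 0ℚ
      rowMix≡0 q = x+y≡0∧x≡0⇒y≡0 (relation-swapped q) (β⊥X q)
      α≡0 : ∀ i → α i ≡ 0ℚ
      α≡0 = rowMix-annihilates⇒zero α (λ c → ∑-zero p (λ q → x≡0⇒x*y≡0 (v q c) (rowMix≡0 q)))

    mixed-relation-trivial : (∀ i → α i ≡ 0ℚ) × (∀ q → β · X q ≡ 0ℚ)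
    mixed-relation-trivial = [ trivial-if-annihilates-v , trivial-if-annihilates-u ]′ annihilates

  combination-trivial : ∀ α μ → combination μ A · ones ≡ 0ℚ →
    (∀ q → rowMix α q ℚ.+ combination μ A · X q ≡ 0ℚ) → (∀ i → α i ≡ 0ℚ) × (∀ j → μ j ≡ 0ℚ)
  combination-trivial α μ β-balanced relation = α≡0 , μ≡0
    where
    β : Fin d → ℚ
    β = combination μ A
    α≡0 : ∀ i → α i ≡ 0ℚ
    α≡0 = proj₁ (mixed-relation-trivial α β β-balanced relation)
    β⊥A : ∀ j → β · A j ≡ 0ℚ
    β⊥A zero = trans (sum-cong-≗ (λ t → cong (β t ℚ.*_) (A-ones t))) β-balanced
    β⊥A (suc i) = trans (sum-cong-≗ (λ t → cong (β t ℚ.*_) (A-sel i t))) (proj₂ (mixed-relation-trivial α β β-balanced relation) (sel i))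
    β≡0 : ∀ t → β t ≡ 0ℚ
    β≡0 = ∑-squares≡0⇒≡0 β (begin
      β · β                               ≡⟨ combination-· μ A β ⟨
      ∑[ j < suc ℓ ] (μ j ℚ.* (A j · β))  ≡⟨ ∑-zero (suc ℓ) (λ j → y≡0⇒x*y≡0 (μ j) (trans (·-comm (A j) β) (β⊥A j))) ⟩
      0ℚ                                  ∎)
      where open ≡-Reasoning
    μ≡0 : ∀ j → μ j ≡ 0ℚ
    μ≡0 = A-independent μ (λ t → trans (sumFin≡∑ (suc ℓ) (λ j → μ j ℚ.* A j t)) (β≡0 t))

  -- A dependency among these r + ℓ + 1 vectors of ℚ^(1+p) is exactly the data of combination-trivial.
  rowVector : Fin r → Fin (suc p) → ℚ
  rowVector i zero = 0ℚ
  rowVector i (suc q) = u q (ρ i)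

  seqVector : Fin (suc ℓ) → Fin (suc p) → ℚ
  seqVector j zero = A j · ones
  seqVector j (suc q) = A j · X q

  jointly-independent : LinIndep (r + suc ℓ) (rowVector ++ seqVector)
  jointly-independent c relation = c≡0
    where
    α : Fin r → ℚ
    α i = c (i ↑ˡ suc ℓ)
    μ : Fin (suc ℓ) → ℚ
    μ j = c (r ↑ʳ j)
    split : ∀ e → ∑[ i < r ] (α i ℚ.* rowVector i e) ℚ.+ ∑[ j < suc ℓ ] (μ j ℚ.* seqVector j e) ≡ 0ℚ
    split e = begin
      ∑[ i < r ] (α i ℚ.* rowVector i e) ℚ.+ ∑[ j < suc ℓ ] (μ j ℚ.* seqVector j e)
        ≡⟨ cong₂ ℚ._+_ (sum-cong-≗ (λ i → cong (λ w → α i ℚ.* w e) (lookup-++ˡ rowVector seqVector i)))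
                       (sum-cong-≗ (λ j → cong (λ w → μ j ℚ.* w e) (lookup-++ʳ rowVector seqVector j))) ⟨
      ∑[ i < r ] (α i ℚ.* (rowVector ++ seqVector) (i ↑ˡ suc ℓ) e) ℚ.+ ∑[ j < suc ℓ ] (μ j ℚ.* (rowVector ++ seqVector) (r ↑ʳ j) e)
        ≡⟨ ∑-↑ r (λ k → c k ℚ.* (rowVector ++ seqVector) k e) ⟨
      ∑[ k < r + suc ℓ ] (c k ℚ.* (rowVector ++ seqVector) k e)
        ≡⟨ sumFin≡∑ (r + suc ℓ) (λ k → c k ℚ.* (rowVector ++ seqVector) k e) ⟨
      sumFin (r + suc ℓ) (λ k → c k ℚ.* (rowVector ++ seqVector) k e)
        ≡⟨ relation e ⟩
      0ℚ ∎
      where open ≡-Reasoning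
    trivial : (∀ i → α i ≡ 0ℚ) × (∀ j → μ j ≡ 0ℚ)
    trivial = combination-trivial α μ
      (trans (sym (combination-· μ A ones)) (x+y≡0∧x≡0⇒y≡0 (split zero) (∑-zero r (λ i → ℚₚ.*-zeroʳ (α i)))))
      (λ q → trans (cong (rowMix α q ℚ.+_) (sym (combination-· μ A (X q)))) (split (suc q)))
    c≡0 : ∀ k → c k ≡ 0ℚ
    c≡0 k with splitAt r k | Finₚ.join-splitAt r (suc ℓ) k
    ... | inj₁ i | refl = proj₁ trivial i
    ... | inj₂ j | refl = proj₂ trivial j

  r+ℓ≤p : r + ℓ ≤ p
  r+ℓ≤p = s≤s⁻¹ (subst (_≤ suc p) (ℕₚ.+-suc r ℓ) (independent⇒length≤dim (rowVector ++ seqVector) jointly-independent))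

rank-bound : ∀ {I : Set} {p d ℓ} {M : I → I → ℚ} {u v : Fin p → I → ℚ} → Factorizes M u v →
  (X : Fin p → Fin d → ℚ) (sel : Fin ℓ → Fin p) (A : Fin (suc ℓ) → Fin d → ℚ) →
  A zero ≗ ones → (∀ i → A (suc i) ≗ X (sel i)) → LinIndep (suc ℓ) A →
  Annihilates X v ⊎ Annihilates X u → ∀ r → RankAtLeast M r → r + ℓ ≤ p
rank-bound M≡uv X sel A A-ones A-sel A-independent annihilates r (ρ , ρ-independent) =
  RankBound.r+ℓ≤p M≡uv X sel A A-ones A-sel A-independent annihilates ρ ρ-independent

rowIndicator colIndicator : ∀ {I : Set} (P : List (Rect I)) → Fin (length P) → I → ℚ
rowIndicator P q ρ = 𝟙 (rowsOf (lookup P q) ρ)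
colIndicator P q c = 𝟙 (colsOf (lookup P q) c)

multiplicity≡∑ : ∀ {I : Set} (P : List (Rect I)) ρ c →
  ℕtoℚ (multiplicity P ρ c) ≡ ∑[ q < length P ] (rowIndicator P q ρ ℚ.* colIndicator P q c)
multiplicity≡∑ [] ρ c = refl
multiplicity≡∑ (R ∷ P) ρ c = trans (ℕtoℚ-𝟙+ (covers R ρ c) (multiplicity P ρ c))
  (cong₂ ℚ._+_ (𝟙-∧ (rowsOf R ρ) (colsOf R c)) (multiplicity≡∑ P ρ c))

multiplicity-outside : ∀ {I : Set} (P : List (Rect I)) (B : I → I → Bool) →
  All (λ R → ∀ r c → rowsOf R r ≡ true → colsOf R c ≡ true → B r c ≡ true) P →
  ∀ ρ c → B ρ c ≡ false → multiplicity P ρ c ≡ 0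
multiplicity-outside [] B [] ρ c _ = refl
multiplicity-outside (R ∷ P) B (R⊆B ∷ P⊆B) ρ c Bρc≡false with rowsOf R ρ in ρ∈R | colsOf R c in c∈R
... | true | true = contradiction (trans (sym (R⊆B ρ c ρ∈R c∈R)) Bρc≡false) (λ ())
... | true | false = multiplicity-outside P B P⊆B ρ c Bρc≡false
... | false | _ = multiplicity-outside P B P⊆B ρ c Bρc≡false

onesPartition-factorizes : ∀ {m n k} (P : List (Rect (Idx m n))) → IsOnesPartition m n k P →
  Factorizes (M-ℚ m n k) (rowIndicator P) (colIndicator P)
onesPartition-factorizes {m} {n} {k} P (P⊆M , covered-once) ρ c with M-entry m n k ρ c in Mρc
... | true = trans (cong ℕtoℚ (sym (covered-once ρ c Mρc))) (multiplicity≡∑ P ρ c)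
... | false = trans (cong ℕtoℚ (sym (multiplicity-outside P (M-entry m n k) P⊆M ρ c Mρc))) (multiplicity≡∑ P ρ c)

∑ℕ : ℕ → (ℕ → ℚ) → ℚ
∑ℕ n f = ∑[ i < n ] f (toℕ i)

∑ℕ-cong< : ∀ n {f g : ℕ → ℚ} → (∀ x → x < n → f x ≡ g x) → ∑ℕ n f ≡ ∑ℕ n g
∑ℕ-cong< n f≡g = sum-cong-≗ (λ i → f≡g (toℕ i) (Finₚ.toℕ<n i))

∑ℕ-+ : ∀ a b (f : ℕ → ℚ) → ∑ℕ (a + b) f ≡ ∑ℕ a f ℚ.+ ∑ℕ b (λ s → f (a + s))
∑ℕ-+ zero b f = sym (ℚₚ.+-identityˡ _)
∑ℕ-+ (suc a) b f = trans (cong (f 0 ℚ.+_) (∑ℕ-+ a b (f ∘ suc))) (sym (ℚₚ.+-assoc (f 0) _ _))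

∑ℕ-suc : ∀ n (f : ℕ → ℚ) → ∑ℕ (suc n) f ≡ ∑ℕ n f ℚ.+ f n
∑ℕ-suc zero f = trans (ℚₚ.+-identityʳ (f 0)) (sym (ℚₚ.+-identityˡ (f 0)))
∑ℕ-suc (suc n) f = trans (cong (f 0 ℚ.+_) (∑ℕ-suc n (f ∘ suc))) (sym (ℚₚ.+-assoc (f 0) _ _))

∑ℕ-shift : ∀ N (f : ℕ → ℚ) → (∀ x → f (x + N) ≡ f x) → ∀ j → ∑ℕ N (λ s → f (j + s)) ≡ ∑ℕ N f
∑ℕ-shift N f f-periodic zero = refl
∑ℕ-shift N f f-periodic (suc j) = trans shifted-once (∑ℕ-shift N f f-periodic j)
  where
  F : ℕ → ℚ
  F s = f (j + s)
  F-wraps : F N ≡ F 0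
  F-wraps = trans (f-periodic j) (cong f (sym (ℕₚ.+-identityʳ j)))
  shifted-once : ∑ℕ N (λ s → f (suc j + s)) ≡ ∑ℕ N F
  shifted-once = +-cancelˡ (F 0) _ _ (begin
    F 0 ℚ.+ ∑ℕ N (λ s → f (suc j + s))  ≡⟨ cong (F 0 ℚ.+_) (∑ℕ-cong< N {F ∘ suc} (λ s _ → cong f (ℕₚ.+-suc j s))) ⟨
    ∑ℕ (suc N) F                        ≡⟨ ∑ℕ-suc N F ⟩
    ∑ℕ N F ℚ.+ F N                      ≡⟨ cong (∑ℕ N F ℚ.+_) F-wraps ⟩
    ∑ℕ N F ℚ.+ F 0                      ≡⟨ ℚₚ.+-comm (∑ℕ N F) (F 0) ⟩
    F 0 ℚ.+ ∑ℕ N F                      ∎)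
    where open ≡-Reasoning

∑ℕ-prefix : ∀ L R (h : ℕ → ℚ) (c : ℕ → Bool) → (∀ s → s < L → c s ≡ true) → (∀ s → s < R → c (L + s) ≡ false) →
  ∑ℕ (L + R) (λ s → h s ℚ.* 𝟙 (c s)) ≡ ∑ℕ L h
∑ℕ-prefix L R h c inside outside = begin
  ∑ℕ (L + R) (λ s → h s ℚ.* 𝟙 (c s))
    ≡⟨ ∑ℕ-+ L R (λ s → h s ℚ.* 𝟙 (c s)) ⟩
  ∑ℕ L (λ s → h s ℚ.* 𝟙 (c s)) ℚ.+ ∑ℕ R (λ s → h (L + s) ℚ.* 𝟙 (c (L + s)))
    ≡⟨ cong₂ ℚ._+_ (∑ℕ-cong< L (λ s s<L → x*𝟙[b]≡x (h s) (inside s s<L)))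
                   (∑-zero R (λ i → x*𝟙[b]≡0 (h (L + toℕ i)) (outside (toℕ i) (Finₚ.toℕ<n i)))) ⟩
  ∑ℕ L h ℚ.+ 0ℚ
    ≡⟨ ℚₚ.+-identityʳ (∑ℕ L h) ⟩
  ∑ℕ L h ∎
  where open ≡-Reasoning

∑ℕ-suffix : ∀ L R (h : ℕ → ℚ) (c : ℕ → Bool) → (∀ s → s < L → c s ≡ false) → (∀ s → s < R → c (L + s) ≡ true) →
  ∑ℕ (L + R) (λ s → h s ℚ.* 𝟙 (c s)) ≡ ∑ℕ R (λ s → h (L + s))
∑ℕ-suffix L R h c outside inside = begin
  ∑ℕ (L + R) (λ s → h s ℚ.* 𝟙 (c s))
    ≡⟨ ∑ℕ-+ L R (λ s → h s ℚ.* 𝟙 (c s)) ⟩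
  ∑ℕ L (λ s → h s ℚ.* 𝟙 (c s)) ℚ.+ ∑ℕ R (λ s → h (L + s) ℚ.* 𝟙 (c (L + s)))
    ≡⟨ cong₂ ℚ._+_ (∑-zero L (λ i → x*𝟙[b]≡0 (h (toℕ i)) (outside (toℕ i) (Finₚ.toℕ<n i))))
                   (∑ℕ-cong< R (λ s s<R → x*𝟙[b]≡x (h (L + s)) (inside s s<R))) ⟩
  0ℚ ℚ.+ ∑ℕ R (λ s → h (L + s))
    ≡⟨ ℚₚ.+-identityˡ _ ⟩
  ∑ℕ R (λ s → h (L + s)) ∎
  where open ≡-Reasoning

countFin≡∑ : ∀ N (f : Fin N → Bool) → ℕtoℚ (countFin N f) ≡ ∑[ j < N ] 𝟙 (f j)
countFin≡∑ zero f = refl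
countFin≡∑ (suc N) f = trans (ℕtoℚ-𝟙+ (f zero) (countFin N (f ∘ suc))) (cong (𝟙 (f zero) ℚ.+_) (countFin≡∑ N (f ∘ suc)))

-- d = 0 only occurs for an empty block, where nothing is summed.
periodicExtension : ∀ d → (Fin d → ℚ) → ℕ → ℚ
periodicExtension zero β x = 0ℚ
periodicExtension (suc d) β x = β (x mod suc d)

∑-residueIndicator : ∀ d (β : Fin (suc d) → ℚ) x →
  ∑[ t < suc d ] (β t ℚ.* 𝟙 ⌊ x % suc d ℕ.≟ toℕ t ⌋) ≡ β (x mod suc d)
∑-residueIndicator d β x = trans (∑-single _ (x mod suc d) off-residue) on-residue
  where
  toℕ-mod : x % suc d ≡ toℕ (x mod suc d)
  toℕ-mod = sym (Finₚ.toℕ-fromℕ< _)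
  on-residue : β (x mod suc d) ℚ.* 𝟙 ⌊ x % suc d ℕ.≟ toℕ (x mod suc d) ⌋ ≡ β (x mod suc d)
  on-residue with x % suc d ℕ.≟ toℕ (x mod suc d)
  ... | yes _ = ℚₚ.*-identityʳ _
  ... | no x%d≢ = contradiction toℕ-mod x%d≢
  off-residue : ∀ t → t ≢ x mod suc d → β t ℚ.* 𝟙 ⌊ x % suc d ℕ.≟ toℕ t ⌋ ≡ 0ℚ
  off-residue t t≢ with x % suc d ℕ.≟ toℕ t
  ... | yes x%d≡t = contradiction (Finₚ.toℕ-injective (trans (sym x%d≡t) toℕ-mod)) t≢
  ... | no _ = ℚₚ.*-zeroʳ (β t)

·-residueSeq : ∀ d N (S : Fin N → Bool) (β : Fin d → ℚ) →
  β · (ℕtoℚ ∘ residueSeq N d S) ≡ ∑[ j < N ] (periodicExtension d β (toℕ j) ℚ.* 𝟙 (S j))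
·-residueSeq zero N S β = sym (∑-zero N (λ j → ℚₚ.*-zeroˡ (𝟙 (S j))))
·-residueSeq (suc d) N S β = begin
  ∑[ t < suc d ] (β t ℚ.* ℕtoℚ (countFin N (λ j → S j ∧ δ j t)))
    ≡⟨ sum-cong-≗ (λ t → cong (β t ℚ.*_) (countFin≡∑ N (λ j → S j ∧ δ j t))) ⟩
  ∑[ t < suc d ] (β t ℚ.* ∑[ j < N ] 𝟙 (S j ∧ δ j t))
    ≡⟨ sum-cong-≗ (λ t → cong (β t ℚ.*_) (sum-cong-≗ (λ j → trans (𝟙-∧ (S j) (δ j t)) (ℚₚ.*-comm (𝟙 (S j)) (𝟙 (δ j t)))))) ⟩
  ∑[ t < suc d ] (β t ℚ.* ∑[ j < N ] (𝟙 (δ j t) ℚ.* 𝟙 (S j)))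
    ≡⟨ ∑-∑-assoc β (λ t j → 𝟙 (δ j t)) (λ j → 𝟙 (S j)) ⟩
  ∑[ j < N ] (∑[ t < suc d ] (β t ℚ.* 𝟙 (δ j t)) ℚ.* 𝟙 (S j))
    ≡⟨ sum-cong-≗ (λ j → cong (ℚ._* 𝟙 (S j)) (∑-residueIndicator d β (toℕ j))) ⟩
  ∑[ j < N ] (β (toℕ j mod suc d) ℚ.* 𝟙 (S j))
    ∎
  where
  open ≡-Reasoning
  δ : Fin N → Fin (suc d) → Bool
  δ j t = ⌊ toℕ j % suc d ℕ.≟ toℕ t ⌋

periodicExtension-periodic : ∀ d β x → periodicExtension d β (x + d) ≡ periodicExtension d β x
periodicExtension-periodic zero β x = refl
periodicExtension-periodic (suc d) β x = cong β (Finₚ.fromℕ<-cong _ _ (DM.[m+n]%n≡m%n x (suc d)) _ _)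

∑ℕ-periodicExtension : ∀ d β → ∑ℕ d (periodicExtension d β) ≡ β · ones
∑ℕ-periodicExtension zero β = refl
∑ℕ-periodicExtension (suc d) β = sum-cong-≗ (λ t → trans (cong β (toℕ-mod t)) (sym (ℚₚ.*-identityʳ (β t))))
  where
  toℕ-mod : ∀ t → toℕ t mod suc d ≡ t
  toℕ-mod t = Finₚ.toℕ-injective (trans (Finₚ.toℕ-fromℕ< _) (DM.m<n⇒m%n≡m (Finₚ.toℕ<n t)))

[m%n+o]%n≡[m+o]%n : ∀ m o n .{{_ : ℕ.NonZero n}} → (m % n + o) % n ≡ (m + o) % n
[m%n+o]%n≡[m+o]%n m o n = begin
  (m % n + o) % n           ≡⟨ DM.%-distribˡ-+ (m % n) o n ⟩
  (m % n % n + o % n) % n   ≡⟨ cong (λ x → (x + o % n) % n) (DM.m%n%n≡m%n m n) ⟩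
  (m % n + o % n) % n       ≡⟨ DM.%-distribˡ-+ m o n ⟨
  (m + o) % n               ∎
  where open ≡-Reasoning

cdiff[a,[a+s]%N]≡s : ∀ N .{{_ : ℕ.NonZero N}} {a s} → a < N → s < N → cdiff N a ((a + s) % N) ≡ s
cdiff[a,[a+s]%N]≡s N {a} {s} a<N s<N with a + s ℕ.<? N
... | yes a+s<N = begin
  cdiff N a ((a + s) % N)   ≡⟨ cong (cdiff N a) (DM.m<n⇒m%n≡m a+s<N) ⟩
  cdiff N a (a + s)         ≡⟨ cong (λ b → if b then a + s ∸ a else a + s + N ∸ a) (dec-true (a ≤? a + s) (ℕₚ.m≤m+n a s)) ⟩
  a + s ∸ a                 ≡⟨ ℕₚ.m+n∸m≡n a s ⟩
  s                         ∎
  where open ≡-Reasoning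
... | no a+s≮N = begin
  cdiff N a ((a + s) % N)   ≡⟨ cong (cdiff N a) wrapped ⟩
  cdiff N a y               ≡⟨ cong (λ b → if b then y ∸ a else y + N ∸ a) (dec-false (a ≤? y) (ℕₚ.<⇒≱ y<a)) ⟩
  y + N ∸ a                 ≡⟨ cong (_∸ a) y+N≡a+s ⟩
  a + s ∸ a                 ≡⟨ ℕₚ.m+n∸m≡n a s ⟩
  s                         ∎
  where
  open ≡-Reasoning
  y : ℕ
  y = a + s ∸ N
  y+N≡a+s : y + N ≡ a + s
  y+N≡a+s = ℕₚ.m∸n+n≡m (ℕₚ.≮⇒≥ a+s≮N)
  y<a : y < a
  y<a = ℕₚ.+-cancelʳ-< N y a (subst (_< a + N) (sym y+N≡a+s) (ℕₚ.+-monoʳ-< a s<N))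
  wrapped : (a + s) % N ≡ y
  wrapped = begin
    (a + s) % N   ≡⟨ cong (_% N) y+N≡a+s ⟨
    (y + N) % N   ≡⟨ DM.[m+n]%n≡m%n y N ⟩
    y % N         ≡⟨ DM.m<n⇒m%n≡m (ℕₚ.<-trans y<a a<N) ⟩
    y             ∎

cdiff[[1+a+s]%N,a]≡N∸[1+s] : ∀ N .{{_ : ℕ.NonZero N}} {a s} → a < N → s < N → cdiff N ((suc a + s) % N) a ≡ N ∸ suc s
cdiff[[1+a+s]%N,a]≡N∸[1+s] N {a} {s} a<N s<N = begin
  cdiff N y a                ≡⟨ cong (cdiff N y) returns ⟨
  cdiff N y ((y + t) % N)    ≡⟨ cdiff[a,[a+s]%N]≡s N (DM.m%n<n (suc a + s) N) (ℕₚ.∸-monoʳ-< z<s s<N) ⟩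
  t                          ∎
  where
  open ≡-Reasoning
  y t : ℕ
  y = (suc a + s) % N
  t = N ∸ suc s
  returns : (y + t) % N ≡ a
  returns = begin
    (y + t) % N              ≡⟨ [m%n+o]%n≡[m+o]%n (suc a + s) t N ⟩
    (suc a + s + t) % N      ≡⟨ cong (λ x → (x + t) % N) (ℕₚ.+-suc a s) ⟨
    (a + suc s + t) % N      ≡⟨ cong (_% N) (ℕₚ.+-assoc a (suc s) t) ⟩
    (a + (suc s + t)) % N    ≡⟨ cong (λ x → (a + x) % N) (ℕₚ.m+[n∸m]≡n s<N) ⟩
    (a + N) % N              ≡⟨ DM.[m+n]%n≡m%n a N ⟩
    a % N                    ≡⟨ DM.m<n⇒m%n≡m a<N ⟩
    a                        ∎

module PeriodicSums {D : ℕ} (g : ℕ → ℚ) (g-periodic : ∀ x → g (x + D) ≡ g x) (g-balanced : ∑ℕ D g ≡ 0ℚ) where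

  g-periodic-multiple : ∀ q x → g (x + q * D) ≡ g x
  g-periodic-multiple zero x = cong g (ℕₚ.+-identityʳ x)
  g-periodic-multiple (suc q) x = begin
    g (x + (D + q * D))   ≡⟨ cong g (ℕₚ.+-assoc x D (q * D)) ⟨
    g (x + D + q * D)     ≡⟨ g-periodic-multiple q (x + D) ⟩
    g (x + D)             ≡⟨ g-periodic x ⟩
    g x                   ∎
    where open ≡-Reasoning

  ∑ℕ-window≡0 : ∀ {L} → D ∣ L → ∀ j → ∑ℕ L (λ s → g (j + s)) ≡ 0ℚ
  ∑ℕ-window≡0 (divides zero refl) j = refl
  ∑ℕ-window≡0 (divides (suc q) refl) j = begin
    ∑ℕ (D + q * D) (λ s → g (j + s))
      ≡⟨ ∑ℕ-+ D (q * D) (λ s → g (j + s)) ⟩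
    ∑ℕ D (λ s → g (j + s)) ℚ.+ ∑ℕ (q * D) (λ s → g (j + (D + s)))
      ≡⟨ cong₂ ℚ._+_ (trans (∑ℕ-shift D g g-periodic j) g-balanced)
                     (trans (∑ℕ-cong< (q * D) (λ s _ → cong g (sym (ℕₚ.+-assoc j D s)))) (∑ℕ-window≡0 (divides q refl) (j + D))) ⟩
    0ℚ ℚ.+ 0ℚ
      ≡⟨⟩
    0ℚ ∎
    where open ≡-Reasoning

  module _ {N K : ℕ} (D∣N : D ∣ N) (D∣K : D ∣ K) (K≤N : K ≤ N) where

    private
      g-N-periodic : ∀ x → g (x + N) ≡ g x
      g-N-periodic x = subst (λ n → g (x + n) ≡ g x) (sym (_∣_.equality D∣N)) (g-periodic-multiple (_∣_.quotient D∣N) x)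

      D∣N∸K : D ∣ N ∸ K
      D∣N∸K = ∣m+n∣m⇒∣n (subst (D ∣_) (sym (ℕₚ.m+[n∸m]≡n K≤N)) D∣N) D∣K

    -- The ones of a row or column of the complemented circulant block form a cyclic interval of
    -- length N ∸ K; rotating the sum by ∑ℕ-shift straightens it into whole periods of g.
    ∑ℕ-circulant≡0 : ∀ {a} → a < N → ∑ℕ N (λ x → g x ℚ.* 𝟙 (K ≤ᵇ cdiff N a x)) ≡ 0ℚ
    ∑ℕ-circulant≡0 {a} a<N = begin
      ∑ℕ N (λ x → g x ℚ.* 𝟙 (K ≤ᵇ cdiff N a x))
        ≡⟨ ∑ℕ-cong< N (λ x x<N → cong (λ y → g x ℚ.* 𝟙 (K ≤ᵇ cdiff N a y)) (DM.m<n⇒m%n≡m x<N)) ⟨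
      ∑ℕ N F
        ≡⟨ ∑ℕ-shift N F F-periodic a ⟨
      ∑ℕ N (λ s → F (a + s))
        ≡⟨ ∑ℕ-cong< N (λ s s<N → cong (λ y → g (a + s) ℚ.* 𝟙 (K ≤ᵇ y)) (cdiff[a,[a+s]%N]≡s N a<N s<N)) ⟩
      ∑ℕ N (λ s → g (a + s) ℚ.* 𝟙 (K ≤ᵇ s))
        ≡⟨ cong (λ n → ∑ℕ n (λ s → g (a + s) ℚ.* 𝟙 (K ≤ᵇ s))) (ℕₚ.m+[n∸m]≡n K≤N) ⟨
      ∑ℕ (K + (N ∸ K)) (λ s → g (a + s) ℚ.* 𝟙 (K ≤ᵇ s))
        ≡⟨ ∑ℕ-suffix K (N ∸ K) (λ s → g (a + s)) (K ≤ᵇ_)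
             (λ s s<K → dec-false (K ≤? s) (ℕₚ.<⇒≱ s<K)) (λ s _ → dec-true (K ≤? K + s) (ℕₚ.m≤m+n K s)) ⟩
      ∑ℕ (N ∸ K) (λ s → g (a + (K + s)))
        ≡⟨ ∑ℕ-cong< (N ∸ K) (λ s _ → cong g (ℕₚ.+-assoc a K s)) ⟨
      ∑ℕ (N ∸ K) (λ s → g (a + K + s))
        ≡⟨ ∑ℕ-window≡0 D∣N∸K (a + K) ⟩
      0ℚ ∎
      where
      open ≡-Reasoning
      instance
        N-nonZero : ℕ.NonZero N
        N-nonZero = ℕ.>-nonZero (ℕₚ.≤-<-trans ℕ.z≤n a<N)
      F : ℕ → ℚ
      F x = g x ℚ.* 𝟙 (K ≤ᵇ cdiff N a (x % N))
      F-periodic : ∀ x → F (x + N) ≡ F x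
      F-periodic x = cong₂ (λ y z → y ℚ.* 𝟙 (K ≤ᵇ cdiff N a z)) (g-N-periodic x) (DM.[m+n]%n≡m%n x N)

    ∑ℕ-circulantᵀ≡0 : ∀ {a} → a < N → ∑ℕ N (λ x → g x ℚ.* 𝟙 (K ≤ᵇ cdiff N x a)) ≡ 0ℚ
    ∑ℕ-circulantᵀ≡0 {a} a<N = begin
      ∑ℕ N (λ x → g x ℚ.* 𝟙 (K ≤ᵇ cdiff N x a))
        ≡⟨ ∑ℕ-cong< N (λ x x<N → cong (λ y → g x ℚ.* 𝟙 (K ≤ᵇ cdiff N y a)) (DM.m<n⇒m%n≡m x<N)) ⟨
      ∑ℕ N F
        ≡⟨ ∑ℕ-shift N F F-periodic (suc a) ⟨
      ∑ℕ N (λ s → F (suc a + s))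
        ≡⟨ ∑ℕ-cong< N (λ s s<N → cong (λ y → g (suc a + s) ℚ.* 𝟙 (K ≤ᵇ y)) (cdiff[[1+a+s]%N,a]≡N∸[1+s] N a<N s<N)) ⟩
      ∑ℕ N (λ s → g (suc a + s) ℚ.* 𝟙 (K ≤ᵇ N ∸ suc s))
        ≡⟨ cong (λ n → ∑ℕ n (λ s → g (suc a + s) ℚ.* 𝟙 (K ≤ᵇ N ∸ suc s))) (ℕₚ.m∸n+n≡m K≤N) ⟨
      ∑ℕ (N ∸ K + K) (λ s → g (suc a + s) ℚ.* 𝟙 (K ≤ᵇ N ∸ suc s))
        ≡⟨ ∑ℕ-prefix (N ∸ K) K (λ s → g (suc a + s)) (λ s → K ≤ᵇ N ∸ suc s) early late ⟩
      ∑ℕ (N ∸ K) (λ s → g (suc a + s))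
        ≡⟨ ∑ℕ-window≡0 D∣N∸K (suc a) ⟩
      0ℚ ∎
      where
      open ≡-Reasoning
      instance
        N-nonZero : ℕ.NonZero N
        N-nonZero = ℕ.>-nonZero (ℕₚ.≤-<-trans ℕ.z≤n a<N)
      F : ℕ → ℚ
      F x = g x ℚ.* 𝟙 (K ≤ᵇ cdiff N (x % N) a)
      F-periodic : ∀ x → F (x + N) ≡ F x
      F-periodic x = cong₂ (λ y z → y ℚ.* 𝟙 (K ≤ᵇ cdiff N z a)) (g-N-periodic x) (DM.[m+n]%n≡m%n x N)
      early : ∀ s → s < N ∸ K → (K ≤ᵇ N ∸ suc s) ≡ true
      early s s<N∸K = dec-true (K ≤? N ∸ suc s)
        (ℕₚ.m+n≤o⇒m≤o∸n K (subst (_≤ N) (ℕₚ.+-comm (suc s) K) (ℕₚ.m≤o∸n⇒m+n≤o (suc s) K≤N s<N∸K)))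
      late : ∀ s → s < K → (K ≤ᵇ N ∸ suc (N ∸ K + s)) ≡ false
      late s s<K = dec-false (K ≤? N ∸ suc (N ∸ K + s))
        (ℕₚ.<⇒≱ (subst (_< K) (sym remaining) (ℕₚ.∸-monoʳ-< z<s s<K)))
        where
        remaining : N ∸ suc (N ∸ K + s) ≡ K ∸ suc s
        remaining = begin
          N ∸ suc (N ∸ K + s)             ≡⟨ cong₂ _∸_ (ℕₚ.m∸n+n≡m K≤N) (ℕₚ.+-suc (N ∸ K) s) ⟨
          (N ∸ K + K) ∸ (N ∸ K + suc s)   ≡⟨ ℕₚ.[m+n]∸[m+o]≡n∸o (N ∸ K) K (suc s) ⟩
          K ∸ suc s                       ∎

M-offBlock : ∀ {m n k} {i i′ : Fin m} → i ≢ i′ → ∀ j j′ → M-ℚ m n k (i , j) (i′ , j′) ≡ 1ℚ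
M-offBlock {i = i} {i′} i≢i′ j j′ with i Fin.≟ i′
... | yes i≡i′ = contradiction i≡i′ i≢i′
... | no _ = refl

-- Block h of M complements D_{n_h, n_h ∸ k_h}, whose ones are the entries with cdiff < n_h ∸ (n_h ∸ k_h).
M-onBlock : ∀ {m n k} {h : Fin m} → k h ≤ n h → ∀ a b →
  M-ℚ m n k (h , a) (h , b) ≡ 𝟙 (k h ≤ᵇ cdiff (n h) (toℕ a) (toℕ b))
M-onBlock {h = h} k≤n a b with h Fin.≟ h
... | no h≢h = contradiction refl h≢h
... | yes refl rewrite ℕₚ.m∸[m∸n]≡n k≤n = cong 𝟙 (not-involutive _)

module BlockSums {m : ℕ} {n k : Fin m → ℕ} (h : Fin m) (k≤n : k h ≤ n h) (g : ℕ → ℚ)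
  (g-periodic : ∀ x → g (x + dBlock m n k h) ≡ g x) (g-balanced : ∑ℕ (dBlock m n k h) g ≡ 0ℚ) where

  open PeriodicSums g g-periodic g-balanced

  private
    d∣N : dBlock m n k h ∣ n h
    d∣N = gcd[m,n]∣m (n h) (k h)
    d∣K : dBlock m n k h ∣ k h
    d∣K = gcd[m,n]∣n (n h) (k h)

  ∑-blockRow≡0 : ∀ c → ∑[ j < n h ] (g (toℕ j) ℚ.* M-ℚ m n k (h , j) c) ≡ 0ℚ
  ∑-blockRow≡0 (i , j₀) = by-block i j₀ (h Fin.≟ i)
    where
    by-block : ∀ i j₀ → Dec (h ≡ i) → ∑[ j < n h ] (g (toℕ j) ℚ.* M-ℚ m n k (h , j) (i , j₀)) ≡ 0ℚ
    by-block .h j₀ (yes refl) = trans (sum-cong-≗ (λ j → cong (g (toℕ j) ℚ.*_) (M-onBlock {m} {n} {k} k≤n j j₀)))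
                                      (∑ℕ-circulantᵀ≡0 d∣N d∣K k≤n (Finₚ.toℕ<n j₀))
    by-block i j₀ (no h≢i) = trans (sum-cong-≗ (λ j → trans (cong (g (toℕ j) ℚ.*_) (M-offBlock {m} {n} {k} h≢i j j₀))
                                                           (ℚₚ.*-identityʳ (g (toℕ j)))))
                                   (∑ℕ-window≡0 d∣N 0)

  ∑-blockCol≡0 : ∀ ρ → ∑[ j < n h ] (g (toℕ j) ℚ.* M-ℚ m n k ρ (h , j)) ≡ 0ℚ
  ∑-blockCol≡0 (i , j₀) = by-block i j₀ (i Fin.≟ h)
    where
    by-block : ∀ i j₀ → Dec (i ≡ h) → ∑[ j < n h ] (g (toℕ j) ℚ.* M-ℚ m n k (i , j₀) (h , j)) ≡ 0ℚ
    by-block .h j₀ (yes refl) = trans (sum-cong-≗ (λ j → cong (g (toℕ j) ℚ.*_) (M-onBlock {m} {n} {k} k≤n j₀ j)))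
                                      (∑ℕ-circulant≡0 d∣N d∣K k≤n (Finₚ.toℕ<n j₀))
    by-block i j₀ (no i≢h) = trans (sum-cong-≗ (λ j → trans (cong (g (toℕ j) ℚ.*_) (M-offBlock {m} {n} {k} i≢h j₀ j))
                                                           (ℚₚ.*-identityʳ (g (toℕ j)))))
                                   (∑ℕ-window≡0 d∣N 0)

annihilates-via-block : ∀ {I : Set} {p d N} {M : I → I → ℚ} {u v : Fin p → I → ℚ} → Factorizes M u v →
  (X : Fin p → Fin d → ℚ) (σ : Fin N → I) →
  (∀ β q → β · X q ≡ ∑[ j < N ] (periodicExtension d β (toℕ j) ℚ.* u q (σ j))) →
  (∀ β → β · ones ≡ 0ℚ → ∀ c → ∑[ j < N ] (periodicExtension d β (toℕ j) ℚ.* M (σ j) c) ≡ 0ℚ) →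
  Annihilates X v
annihilates-via-block {p = p} {d} {N} {M} {u} {v} M≡uv X σ X≡ block≡0 β β-balanced c = begin
  ∑[ q < p ] (β · X q ℚ.* v q c)
    ≡⟨ sum-cong-≗ (λ q → cong (ℚ._* v q c) (X≡ β q)) ⟩
  ∑[ q < p ] (∑[ j < N ] (periodicExtension d β (toℕ j) ℚ.* u q (σ j)) ℚ.* v q c)
    ≡⟨ rowCombination {M = M} {u} {v} M≡uv σ (λ j → periodicExtension d β (toℕ j)) c ⟨
  ∑[ j < N ] (periodicExtension d β (toℕ j) ℚ.* M (σ j) c)
    ≡⟨ block≡0 β β-balanced c ⟩
  0ℚ ∎
  where open ≡-Reasoning

blockSeqs : (m : ℕ) (n k : Fin m → ℕ) → Side → (h : Fin m) (P : List (Rect (Idx m n))) →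
  Fin (length P) → Fin (dBlock m n k h) → ℚ
blockSeqs m n k side h P q t = ℕtoℚ (blockSeq m n k side h (lookup P q) t)

module _ {m : ℕ} {n k : Fin m → ℕ} (k≤n : ∀ i → k i ≤ n i) (P : List (Rect (Idx m n)))
         (partition : IsOnesPartition m n k P) (h : Fin m) where

  private
    d : ℕ
    d = dBlock m n k h
    M≡uv : Factorizes (M-ℚ m n k) (rowIndicator P) (colIndicator P)
    M≡uv = onesPartition-factorizes P partition
    module Block (β : Fin d → ℚ) (β-balanced : β · ones ≡ 0ℚ) =
      BlockSums {m} {n} {k} h (k≤n h) (periodicExtension d β) (periodicExtension-periodic d β)
        (trans (∑ℕ-periodicExtension d β) β-balanced)

  blockSeqs-annihilate : ∀ side →
    Annihilates (blockSeqs m n k side h P) (colIndicator P) ⊎ Annihilates (blockSeqs m n k side h P) (rowIndicator P)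
  blockSeqs-annihilate rowSide =
    inj₁ (annihilates-via-block {M = M-ℚ m n k} {rowIndicator P} {colIndicator P} M≡uv
           (blockSeqs m n k rowSide h P) (λ j → h , j)
           (λ β q → ·-residueSeq d (n h) (λ j → rowsOf (lookup P q) (h , j)) β) Block.∑-blockRow≡0)
  blockSeqs-annihilate colSide =
    inj₂ (annihilates-via-block {M = λ ρ c → M-ℚ m n k c ρ} {colIndicator P} {rowIndicator P}
           (Factorizes-transpose {M = M-ℚ m n k} {rowIndicator P} {colIndicator P} M≡uv)
           (blockSeqs m n k colSide h P) (λ j → h , j)
           (λ β q → ·-residueSeq d (n h) (λ j → colsOf (lookup P q) (h , j)) β) Block.∑-blockCol≡0)

lemma4p2 : (m : ℕ) → 1 ≤ m → (n k : Fin m → ℕ) → ((i : Fin m) → k i ≤ n i)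
    → (P : List (Rect (Idx m n))) → IsOnesPartition m n k P
    → (h : Fin m) → (side : Side) → (ℓ : ℕ)
    → (sel : Fin ℓ → Fin (length P)) → Injective _≡_ _≡_ sel
    → LinIndep (suc ℓ) (seqFamily m n k side h ℓ (λ i → lookup P (sel i)))
    → (r : ℕ) → RankAtLeast (M-ℚ m n k) r
    → r + ℓ ≤ length P
lemma4p2 m _ n k k≤n P partition h side ℓ sel _ independent r rank =
  rank-bound (onesPartition-factorizes P partition) (blockSeqs m n k side h P) sel
    (seqFamily m n k side h ℓ (λ i → lookup P (sel i))) (λ _ → refl) (λ _ _ → refl) independent
    (blockSeqs-annihilate k≤n P partition h side) r rank
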